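{- For every $k\in\mathbb{N}$, the class of (finite) graphs $G$ with $\chi_{\mathrm{lin}}(G)\leq k$ has only finitely many obstructions with respect to the subgraph relation, i.e., there are finitely many graphs (up to isomorphism) $H$ with $\chi_{\mathrm{lin}}(H)>k$ such that every proper subgraph $H'$ of $H$ satisfies $\chi_{\mathrm{lin}}(H')\leq k$.
   Context: A linear coloring of a graph $G$ is an assignment of integers (colors) to its vertices such that every path of $G$ (as a subgraph) contains a vertex whose color appears exactly once on that path; $\chi_{\mathrm{lin}}(G)$ is the minimum number of colors in a linear coloring of $G$. -}

module Defs where

open import Data.Nat using (ℕ)
open import Data.Fin using (Fin; _≟_)
open import Data.Bool using (Bool; true; false)
open import Data.List using (List; []; _∷_; length; filter)
open import Data.List.Relation.Unary.Linked using (Linked)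
open import Data.List.Relation.Unary.Unique.Propositional using (Unique)
open import Data.List.Relation.Unary.Any using (Any)
open import Data.List.Membership.Propositional using (_∈_)
open import Data.Product using (Σ; ∃; _×_)
open import Relation.Binary.PropositionalEquality using (_≡_; _≢_)
open import Relation.Nullary using (¬_)
open import Function.Definitions using (Injective)

record Graph : Set where
  field
    n     : ℕ
    adj   : Fin n → Fin n → Bool
    sym   : ∀ u v → adj u v ≡ adj v u
    irref : ∀ v → adj v v ≡ false
open Graph public

IsPath : (G : Graph) → List (Fin (n G)) → Set
IsPath G p = (p ≢ []) × Unique p × Linked (λ u v → adj G u v ≡ true) p

LinearColoring : (G : Graph) (k : ℕ) → (Fin (n G) → Fin k) → Set
LinearColoring G k c =
  ∀ (p : List (Fin (n G))) → IsPath G p →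
    ∃ λ v → v ∈ p × length (filter (λ w → c w ≟ c v) p) ≡ 1

χlin≤ : Graph → ℕ → Set
χlin≤ G k = Σ (Fin (n G) → Fin k) (LinearColoring G k)

record _≅_ (G H : Graph) : Set where
  field
    to     : Fin (n G) → Fin (n H)
    from   : Fin (n H) → Fin (n G)
    to∘from : ∀ x → to (from x) ≡ x
    from∘to : ∀ x → from (to x) ≡ x
    adj-pres : ∀ u v → adj H (to u) (to v) ≡ adj G u v

record _⊆_ (H' H : Graph) : Set where
  field
    emb     : Fin (n H') → Fin (n H)
    inj     : Injective _≡_ _≡_ emb
    edge    : ∀ u v → adj H' u v ≡ true → adj H (emb u) (emb v) ≡ true

_⊂_ : Graph → Graph → Set
H' ⊂ H = (H' ⊆ H) × ¬ (H' ≅ H)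

Obstruction : ℕ → Graph → Set
Obstruction k H = ¬ χlin≤ H k × (∀ H' → H' ⊂ H → χlin≤ H' k)

-- Let H be an obstruction: H is not linearly k-colourable, but every H ─ v is.
--
-- Paths of H have at most 2^k vertices.  Dropping the first vertex v leaves a path of H ─ v,
-- and the uniquely coloured vertex of such a path splits it into two paths avoiding its
-- colour, so by induction on the palette it has fewer than 2^k vertices.
--
-- H contains no large family of replicas, i.e. disjoint copies of a piece X, alike as seen
-- from a vertex set A that contains every outside neighbour of the first copy.  Otherwise
-- colour H minus a vertex of the first copy, pick by pigeonhole 2^k + 1 copies coloured alike
-- and give the first copy their colours: a path of H misses one of these copies, and swapping
-- the first copy with it turns the path into a path of H ─ v carrying the same colours.
--
-- These two facts bound |H|.  By induction on the depth, a connected vertex set U rooted at r,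
-- left only towards A and with short paths from r, has size bounded in terms of its depth and
-- |A|: the components of U ─ r hang off neighbours of r, are bounded by induction (with r added
-- to A), and too many of them would contain many with the same profile (size and adjacencies
-- inside and towards A), i.e. replicas.
--
-- Obstructions are therefore among the finitely many graphs with at most obstructionBound k
-- vertices.  As n H ≤ obstructionBound k is decidable, it can be proved under double negation,
-- which is where connectivity gets decided.

module Submission where

open import Defs hiding (sym)
open import Level using (0ℓ)
open import Effect.Monad using (RawMonad)
open import Data.Nat as ℕ using (ℕ; zero; suc; _+_; _*_; _^_; _≤_; _<_; z≤n; s≤s)
open import Data.Nat.Properties as ℕ using (≤-refl; ≤-trans; <-≤-trans; n≮0)
open import Data.Fin as Fin using (Fin; zero; suc; toℕ)
import Data.Fin.Properties as Fin
open import Data.List using (List; []; _∷_; length; filter; map; _++_; allFin; lookup; head; drop; upTo; cartesianProductWith; concatMap)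
open import Data.List.Properties using (filter-notAll; filter-++; length-++; length-map; length-tabulate; length-upTo)
open import Data.List.Relation.Unary.All as All using (All; []; _∷_)
open import Data.List.Relation.Unary.Any as Any using (Any; here; there)
open import Data.List.Relation.Unary.AllPairs using (AllPairs; []; _∷_)
open import Data.List.Relation.Unary.Linked as Linked using (Linked; []; [-]; _∷_)
import Data.List.Relation.Unary.Linked.Properties as Linked
open import Data.List.Relation.Unary.Unique.Propositional using (Unique)
import Data.List.Relation.Unary.Unique.Propositional.Properties as Unique
import Data.List.Relation.Unary.All.Properties as All
import Data.List.Relation.Unary.Any.Properties as Any
open import Data.List.Membership.Propositional using (_∈_; _∉_; find)
import Data.List.Membership.DecPropositional as DecMembership
open import Data.List.Membership.Propositional.Properties using (∈-filter⁺; ∈-filter⁻; ∈-map⁺; ∈-map⁻; ∈-∃++; ∈-allFin; ∈-lookup; ∈-upTo⁺; ∈-++⁺ˡ; ∈-++⁺ʳ; ∈-cartesianProductWith⁺)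
open import Data.List.Relation.Binary.Subset.Propositional using () renaming (_⊆_ to _⊆ₗ_)
open import Data.Product using (∃; _×_; _,_; proj₁; proj₂)
open import Data.Sum using (_⊎_; inj₁; inj₂)
open import Data.Empty using (⊥)
open import Data.Unit using (⊤; tt)
open import Data.Maybe using (Maybe; just; nothing)
open import Data.Bool using (Bool; true; false; if_then_else_; _∧_)
open import Data.Bool.Properties using (∧-comm; ∧-idem)
open import Data.Vec as Vec using (Vec; []; _∷_)
import Data.Vec.Properties as Vec
open import Function using (_∘_; id)
open import Function.Definitions using (Injective)
open import Relation.Nullary using (¬_; Dec; yes; no; does; ¬?; contradiction)
open import Relation.Nullary.Negation using (¬¬-Monad; DoubleNegation)
open import Relation.Nullary.Decidable using (¬¬-excluded-middle; decidable-stable)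
open import Relation.Unary using (Decidable)
open import Relation.Unary.Properties using (∁?)
open import Relation.Binary.Definitions using (DecidableEquality)
open import Relation.Binary.PropositionalEquality
  using (_≡_; _≢_; refl; sym; trans; cong; cong₂; subst; subst₂; module ≡-Reasoning)

open RawMonad (¬¬-Monad {0ℓ})

¬¬-∀Fin : ∀ {m} {P : Fin m → Set} → (∀ i → DoubleNegation (P i)) → DoubleNegation (∀ i → P i)
¬¬-∀Fin {zero}  f = pure λ ()
¬¬-∀Fin {suc m} f = do
  p₀ ← f zero
  ps ← ¬¬-∀Fin (f ∘ suc)
  pure λ { zero → p₀ ; (suc i) → ps i }

¬¬-All : ∀ {A : Set} {Q : A → Set} xs → (∀ {x} → x ∈ xs → DoubleNegation (Q x)) →
         DoubleNegation (All Q xs)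
¬¬-All []       f = pure []
¬¬-All (x ∷ xs) f = do
  q  ← f (here refl)
  qs ← ¬¬-All xs (f ∘ there)
  pure (q ∷ qs)

module _ {A : Set} {P : A → Set} (P? : Decidable P) where

  length-filter-∁ : ∀ xs → length (filter P? xs) + length (filter (∁? P?) xs) ≡ length xs
  length-filter-∁ []       = refl
  length-filter-∁ (x ∷ xs) with P? x
  ... | yes _ = cong suc (length-filter-∁ xs)
  ... | no  _ = trans (ℕ.+-suc _ _) (cong suc (length-filter-∁ xs))

module _ {A B : Set} (_≟_ : DecidableEquality B) {R : A → B → Set}
         (R-injective : ∀ {a a′ b} → R a b → R a′ b → a ≡ a′) where

  length-≤-by-injection : ∀ {as bs} → Unique as → All (λ a → Any (R a) bs) as →
                          length as ≤ length bs
  length-≤-by-injection {[]}     _          _           = z≤n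
  length-≤-by-injection {a ∷ as} {bs} (a∉as ∷ u) (Ra ∷ Ras) with find Ra
  ... | b , b∈bs , Rab =
    <-≤-trans (s≤s (length-≤-by-injection u (All.tabulate (λ a′∈as → avoids-b a′∈as (All.lookup Ras a′∈as)))))
              (filter-notAll (λ y → ¬? (y ≟ b)) bs (Any.map (λ { refl b≢b → b≢b refl }) b∈bs))
    where
      avoids-b : ∀ {a′} → a′ ∈ as → Any (R a′) bs → Any (R a′) (filter (λ y → ¬? (y ≟ b)) bs)
      avoids-b a′∈as Ra′ with find Ra′
      ... | b′ , b′∈bs , Ra′b′ =
        Any.map (λ { refl → Ra′b′ })
          (∈-filter⁺ (λ y → ¬? (y ≟ b)) b′∈bs (λ { refl → All.lookup a∉as a′∈as (R-injective Rab Ra′b′) }))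

length-≤-⊆ : ∀ {A : Set} → DecidableEquality A → ∀ {as bs : List A} → Unique as → as ⊆ₗ bs → length as ≤ length bs
length-≤-⊆ _≟_ u as⊆bs = length-≤-by-injection _≟_ (λ { refl refl → refl }) u (All.tabulate as⊆bs)

module _ {A : Set} (_≟_ : DecidableEquality A) where

  length-filter-≢ : ∀ r {xs} → Unique xs → length xs ≤ suc (length (filter (λ y → ¬? (y ≟ r)) xs))
  length-filter-≢ r {xs} u = begin
    length xs                                                 ≡⟨ length-filter-∁ ≡r? xs ⟨
    length (filter ≡r? xs) + length (filter (∁? ≡r?) xs)      ≤⟨ ℕ.+-monoˡ-≤ _ at-most-r ⟩
    suc (length (filter (∁? ≡r?) xs))                         ∎
    where
      open ℕ.≤-Reasoning
      ≡r? : Decidable (_≡ r)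
      ≡r? y = y ≟ r
      at-most-r : length (filter ≡r? xs) ≤ 1
      at-most-r = length-≤-⊆ _≟_ {bs = r ∷ []} (Unique.filter⁺ ≡r? u) (here ∘ proj₂ ∘ ∈-filter⁻ ≡r? {xs = xs})

module _ {A : Set} where

  lookup-injective : ∀ {xs : List A} → Unique xs → ∀ {i j} → lookup xs i ≡ lookup xs j → i ≡ j
  lookup-injective {_ ∷ _} _          {zero}  {zero}  _    = refl
  lookup-injective         (x∉ ∷ _)   {zero}  {suc j} same = contradiction same (All.lookup x∉ (∈-lookup j))
  lookup-injective         (x∉ ∷ _)   {suc i} {zero}  same = contradiction (sym same) (All.lookup x∉ (∈-lookup i))
  lookup-injective         (_  ∷ u)   {suc i} {suc j} same = cong suc (lookup-injective u same)

  head-drop-lookup : ∀ (xs : List A) i → head (drop (toℕ i) xs) ≡ just (lookup xs i)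
  head-drop-lookup (_ ∷ _)  zero    = refl
  head-drop-lookup (_ ∷ xs) (suc i) = head-drop-lookup xs i

  at : ∀ {m} (xs : List A) → length xs ≡ m → Fin m → A
  at xs |xs|≡m i = lookup xs (Fin.cast (sym |xs|≡m) i)

  module _ {m} {xs : List A} (|xs|≡m : length xs ≡ m) where

    at-∈ : ∀ i → at xs |xs|≡m i ∈ xs
    at-∈ i = ∈-lookup _

    at-injective : Unique xs → Injective _≡_ _≡_ (at xs |xs|≡m)
    at-injective u {i} {j} same = Fin.toℕ-injective (begin
      toℕ i                              ≡⟨ Fin.toℕ-cast (sym |xs|≡m) i ⟨
      toℕ (Fin.cast (sym |xs|≡m) i)      ≡⟨ cong toℕ (lookup-injective u same) ⟩
      toℕ (Fin.cast (sym |xs|≡m) j)      ≡⟨ Fin.toℕ-cast (sym |xs|≡m) j ⟩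
      toℕ j                              ∎)
      where open ≡-Reasoning

    at-surjective : ∀ {x} → x ∈ xs → ∃ λ i → at xs |xs|≡m i ≡ x
    at-surjective x∈ = Fin.cast |xs|≡m (Any.index x∈) , (begin
      lookup xs (Fin.cast (sym |xs|≡m) (Fin.cast |xs|≡m (Any.index x∈))) ≡⟨ cong (lookup xs) (Fin.cast-involutive (sym |xs|≡m) |xs|≡m _) ⟩
      lookup xs (Any.index x∈)                                             ≡⟨ Any.lookup-index x∈ ⟨
      _                                                                    ∎)
      where open ≡-Reasoning

    head-drop-at : ∀ i → head (drop (toℕ i) xs) ≡ just (at xs |xs|≡m i)
    head-drop-at i = trans (cong (λ j → head (drop j xs)) (sym (Fin.toℕ-cast (sym |xs|≡m) i)))
                           (head-drop-lookup xs (Fin.cast (sym |xs|≡m) i))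

length-nonempty : ∀ {A : Set} {x : A} {xs} → x ∈ xs → length xs ≡ suc (ℕ.pred (length xs))
length-nonempty {xs = _ ∷ _} _ = refl

AllPairs-lookup : ∀ {A : Set} {R : A → A → Set} → (∀ {a b} → R a b → R b a) → ∀ {xs} → AllPairs R xs →
                  ∀ {a b} → a ∈ xs → b ∈ xs → a ≢ b → R a b
AllPairs-lookup R-sym (_   ∷ _)   (here refl) (here refl) a≢b = contradiction refl a≢b
AllPairs-lookup R-sym (Rx ∷ _)   (here refl) (there b∈)  _   = All.lookup Rx b∈
AllPairs-lookup R-sym (Rx ∷ _)   (there a∈)  (here refl) _   = R-sym (All.lookup Rx a∈)
AllPairs-lookup R-sym (_  ∷ Rxs) (there a∈)  (there b∈)  a≢b = AllPairs-lookup R-sym Rxs a∈ b∈ a≢b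

length-cartesianProductWith : ∀ {A B C : Set} (f : A → B → C) xs ys →
                              length (cartesianProductWith f xs ys) ≡ length xs * length ys
length-cartesianProductWith f []       ys = refl
length-cartesianProductWith f (x ∷ xs) ys = begin
  length (map (f x) ys ++ cartesianProductWith f xs ys)           ≡⟨ length-++ (map (f x) ys) ⟩
  length (map (f x) ys) + length (cartesianProductWith f xs ys)   ≡⟨ cong₂ _+_ (length-map (f x) ys) (length-cartesianProductWith f xs ys) ⟩
  length ys + length xs * length ys                               ∎
  where open ≡-Reasoning


Unique-map⁺ : ∀ {A B : Set} (f : A → B) {xs} → (∀ {x y} → x ∈ xs → y ∈ xs → f x ≡ f y → x ≡ y) →
              Unique xs → Unique (map f xs)
Unique-map⁺ f {[]}     _   []           = []
Unique-map⁺ f {x ∷ xs} inj (x∉xs ∷ u) =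
  All.map⁺ (All.tabulate (λ y∈xs fx≡fy → All.lookup x∉xs y∈xs (inj (here refl) (there y∈xs) fx≡fy))) ∷
  Unique-map⁺ f (λ x∈ y∈ → inj (there x∈) (there y∈)) u

module _ {A : Set} {R : A → A → Set} where

  AllPairs-++⁻ˡ : ∀ xs {ys} → AllPairs R (xs ++ ys) → AllPairs R xs
  AllPairs-++⁻ˡ []       _          = []
  AllPairs-++⁻ˡ (x ∷ xs) (px ∷ pxs) = All.++⁻ˡ xs px ∷ AllPairs-++⁻ˡ xs pxs

  AllPairs-++⁻ʳ : ∀ xs {ys} → AllPairs R (xs ++ ys) → AllPairs R ys
  AllPairs-++⁻ʳ []       pxs       = pxs
  AllPairs-++⁻ʳ (x ∷ xs) (_ ∷ pxs) = AllPairs-++⁻ʳ xs pxs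

  Linked-++⁻ˡ : ∀ xs {ys} → Linked R (xs ++ ys) → Linked R xs
  Linked-++⁻ˡ []            _         = []
  Linked-++⁻ˡ (x ∷ [])      _         = [-]
  Linked-++⁻ˡ (x ∷ y ∷ xs)  (r ∷ rs)  = r ∷ Linked-++⁻ˡ (y ∷ xs) rs

  Linked-++⁻ʳ : ∀ xs {ys} → Linked R (xs ++ ys) → Linked R ys
  Linked-++⁻ʳ []           rs       = rs
  Linked-++⁻ʳ (x ∷ [])     [-]      = []
  Linked-++⁻ʳ (x ∷ [])     (_ ∷ rs) = rs
  Linked-++⁻ʳ (x ∷ y ∷ xs) (_ ∷ rs) = Linked-++⁻ʳ (y ∷ xs) rs

-- Pigeonhole

ConstantOn : {X : Set} → (X → ℕ) → List X → Set
ConstantOn f ys = ∀ {x y} → x ∈ ys → y ∈ ys → f x ≡ f y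

record LargeSublist {X : Set} (P : List X → Set) (m : ℕ) (xs : List X) : Set where
  field
    elems    : List X
    unique   : Unique elems
    ⊆xs      : elems ⊆ₗ xs
    large    : m < length elems
    property : P elems
open LargeSublist

widen : ∀ {X : Set} {P : List X → Set} {m ys xs} → ys ⊆ₗ xs → LargeSublist P m ys → LargeSublist P m xs
widen ys⊆xs S = record
  { elems = elems S ; unique = unique S ; ⊆xs = ys⊆xs ∘ ⊆xs S ; large = large S ; property = property S }

module _ {X : Set} (f : X → ℕ) where

  fibre? : ∀ v → Decidable (λ x → f x ≡ v)
  fibre? v x = f x ℕ.≟ v

  pigeonhole : ∀ K {m xs} → Unique xs → (∀ {x} → x ∈ xs → f x < K) → K * m < length xs →
               LargeSublist (ConstantOn f) m xs
  pigeonhole zero {xs = []}    _ _  ()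
  pigeonhole zero {xs = _ ∷ _} _ bd _ = contradiction (bd (here refl)) n≮0
  pigeonhole (suc K) {m} {xs} u bd xs-large with m ℕ.<? length (filter (fibre? K) xs)
  ... | yes big = record
    { elems    = filter (fibre? K) xs
    ; unique   = Unique.filter⁺ (fibre? K) u
    ; ⊆xs      = proj₁ ∘ ∈-filter⁻ (fibre? K)
    ; large    = big
    ; property = λ x∈ y∈ → trans (proj₂ (∈-filter⁻ (fibre? K) {xs = xs} x∈)) (sym (proj₂ (∈-filter⁻ (fibre? K) {xs = xs} y∈)))
    }
  ... | no small = widen (proj₁ ∘ ∈-filter⁻ (∁? (fibre? K))) S
    where
      rest : List X
      rest = filter (∁? (fibre? K)) xs
      rest-bounded : ∀ {x} → x ∈ rest → f x < K
      rest-bounded x∈ with ∈-filter⁻ (∁? (fibre? K)) x∈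
      ... | x∈xs , fx≢K = ℕ.≤∧≢⇒< (ℕ.≤-pred (bd x∈xs)) fx≢K
      rest-large : K * m < length rest
      rest-large = ℕ.≰⇒> λ rest≤ → ℕ.<⇒≱ xs-large
        (subst (_≤ m + K * m) (length-filter-∁ (fibre? K) xs) (ℕ.+-mono-≤ (ℕ.≮⇒≥ small) rest≤))
      S : LargeSublist (ConstantOn f) m rest
      S = pigeonhole K (Unique.filter⁺ (∁? (fibre? K)) u) rest-bounded rest-large

module _ {F X : Set} (val : F → X → ℕ) where

  Homogeneous : List F → List X → Set
  Homogeneous φs ys = ∀ {φ} → φ ∈ φs → ConstantOn (val φ) ys

  multi-pigeonhole : ∀ K φs {m xs} → Unique xs → (∀ {x} → x ∈ xs → ∀ φ → val φ x < K) →
                     K ^ length φs * m < length xs → LargeSublist (Homogeneous φs) m xs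
  multi-pigeonhole K [] {m} {xs} u _ xs-large = record
    { elems = xs ; unique = u ; ⊆xs = λ x∈ → x∈
    ; large = subst (_< length xs) (ℕ.*-identityˡ m) xs-large ; property = λ () }
  multi-pigeonhole K (φ ∷ φs) {m} {xs} u bd xs-large = record
    { elems    = elems S
    ; unique   = unique S
    ; ⊆xs      = ⊆xs S₁ ∘ ⊆xs S
    ; large    = large S
    ; property = λ { (here refl) x∈ y∈ → property S₁ (⊆xs S x∈) (⊆xs S y∈)
                   ; (there φ∈)        → property S φ∈ }
    }
    where
      S₁ : LargeSublist (ConstantOn (val φ)) (K ^ length φs * m) xs
      S₁ = pigeonhole (val φ) K u (λ x∈ → bd x∈ φ)
             (subst (_< length xs) (ℕ.*-assoc K (K ^ length φs) m) xs-large)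
      S : LargeSublist (Homogeneous φs) m (elems S₁)
      S = multi-pigeonhole K φs (unique S₁) (λ x∈ → bd (⊆xs S₁ x∈)) (large S₁)

module _ {A : Set} {k : ℕ} (c : A → Fin k) where

  count : Fin k → List A → ℕ
  count a = length ∘ filter (λ w → c w Fin.≟ a)

  UniquelyColoured : List A → Set
  UniquelyColoured p = ∃ λ v → v ∈ p × count (c v) p ≡ 1

  count-++ : ∀ a xs ys → count a (xs ++ ys) ≡ count a xs + count a ys
  count-++ a xs ys = trans (cong length (filter-++ (λ w → c w Fin.≟ a) xs ys)) (length-++ (filter _ xs))

  count≡0⇒absent : ∀ a xs → count a xs ≡ 0 → All (λ w → c w ≢ a) xs
  count≡0⇒absent a []       _ = []
  count≡0⇒absent a (x ∷ xs) e with c x Fin.≟ a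
  ... | yes _   = contradiction e λ ()
  ... | no  c≢a = c≢a ∷ count≡0⇒absent a xs e

  count-self : ∀ v xs → count (c v) (v ∷ xs) ≡ suc (count (c v) xs)
  count-self v xs with c v Fin.≟ c v
  ... | yes _   = refl
  ... | no  c≢c = contradiction refl c≢c

module _ {A B : Set} {k : ℕ} (f : A → B) {c : A → Fin k} {c′ : B → Fin k} where

  count-map : ∀ a {p} → (∀ {x} → x ∈ p → c x ≡ c′ (f x)) → count c a p ≡ count c′ a (map f p)
  count-map a {[]}    _  = refl
  count-map a {x ∷ p} eq with c x Fin.≟ a | c′ (f x) Fin.≟ a
  ... | yes _   | yes _   = cong suc (count-map a (eq ∘ there))
  ... | no  _   | no  _   = count-map a (eq ∘ there)
  ... | yes cx≡ | no  c′≢ = contradiction (trans (sym (eq (here refl))) cx≡) c′≢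
  ... | no  cx≢ | yes c′≡ = contradiction (trans (eq (here refl)) c′≡) cx≢

  UniquelyColoured-map⁺ : ∀ {p} → (∀ {x} → x ∈ p → c x ≡ c′ (f x)) →
                          UniquelyColoured c p → UniquelyColoured c′ (map f p)
  UniquelyColoured-map⁺ {p} eq (v , v∈p , once) =
    f v , ∈-map⁺ f v∈p , trans (sym (count-map (c′ (f v)) eq)) (subst (λ a → count c a p ≡ 1) (eq v∈p) once)

  UniquelyColoured-map⁻ : ∀ {p} → (∀ {x} → x ∈ p → c x ≡ c′ (f x)) →
                          UniquelyColoured c′ (map f p) → UniquelyColoured c p
  UniquelyColoured-map⁻ {p} eq (v′ , v′∈ , once) with ∈-map⁻ f v′∈
  ... | v , v∈p , refl = v , v∈p , trans (count-map (c v) eq) (subst (λ a → count c′ a (map f p) ≡ 1) (sym (eq v∈p)) once)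

-- Linearly coloured paths are short

Edge : (G : Graph) → Fin (n G) → Fin (n G) → Set
Edge G u v = adj G u v ≡ true

Edge-sym : ∀ G {u v} → Edge G u v → Edge G v u
Edge-sym G {u} {v} e = trans (Graph.sym G v u) e

IsPath-map : ∀ {G H} (f : Fin (n G) → Fin (n H)) {p} → (∀ {x y} → x ∈ p → y ∈ p → f x ≡ f y → x ≡ y) →
             (∀ {x y} → Edge G x y → Edge H (f x) (f y)) → IsPath G p → IsPath H (map f p)
IsPath-map f {x ∷ _} inj edge (_ , u , l) = (λ ()) , Unique-map⁺ f inj u , Linked.map⁺ (Linked.map edge l)
IsPath-map f {[]}    _   _    ([]≢[] , _) = contradiction refl []≢[]

module _ (D : Graph) {k : ℕ} {c : Fin (n D) → Fin k} (linear : LinearColoring D k c) where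

  split-at-unique : ∀ t S → length S ≤ suc t → ∀ p → p ≢ [] → Unique p → Linked (Edge D) p →
                    All (λ x → c x ∈ S) p → length p < 2 ^ suc t

  palette-bound : ∀ t S → length S ≤ t → ∀ p → Unique p → Linked (Edge D) p →
                  All (λ x → c x ∈ S) p → length p < 2 ^ t
  palette-bound t       S       _     []        _ _ _        = ℕ.m^n>0 2 t
  palette-bound zero    []      _     (_ ∷ _)   _ _ (() ∷ _)
  palette-bound zero    (_ ∷ _) ()    (_ ∷ _)   _ _ _
  palette-bound (suc t) S       |S|≤  p@(_ ∷ _) u l inS      = split-at-unique t S |S|≤ p (λ ()) u l inS

  split-at-unique t S |S|≤ p p≢[] u l inS with linear p (p≢[] , u , l)
  ... | v , v∈p , once with ∈-∃++ v∈p
  ... | as , cs , refl = begin-strict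
    length (as ++ v ∷ cs)       ≡⟨ length-++ as ⟩
    length as + suc (length cs) <⟨ ℕ.+-mono-<-≤ as-bound cs-bound ⟩
    2 ^ t + 2 ^ t               ≡⟨ cong (2 ^ t +_) (sym (ℕ.+-identityʳ (2 ^ t))) ⟩
    2 ^ suc t                   ∎
    where
      open ℕ.≤-Reasoning
      S′ : List (Fin k)
      S′ = filter (λ a → ¬? (a Fin.≟ c v)) S
      |S′|≤ : length S′ ≤ t
      |S′|≤ = ℕ.≤-pred (<-≤-trans (filter-notAll _ S (Any.map (λ { refl ≢cv → ≢cv refl }) (All.lookup inS v∈p))) |S|≤)
      others-absent : count c (c v) as + count c (c v) cs ≡ 0
      others-absent = ℕ.suc-injective (begin-equality
        suc (count c (c v) as + count c (c v) cs) ≡⟨ sym (ℕ.+-suc _ _) ⟩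
        count c (c v) as + suc (count c (c v) cs) ≡⟨ cong (count c (c v) as +_) (sym (count-self c v cs)) ⟩
        count c (c v) as + count c (c v) (v ∷ cs) ≡⟨ sym (count-++ c (c v) as (v ∷ cs)) ⟩
        count c (c v) (as ++ v ∷ cs)              ≡⟨ once ⟩
        1                                         ∎)
      restrict : ∀ xs → count c (c v) xs ≡ 0 → All (λ x → c x ∈ S) xs → All (λ x → c x ∈ S′) xs
      restrict xs none inS′ = All.zipWith (λ (cx≢cv , cx∈S) → ∈-filter⁺ _ cx∈S cx≢cv)
                                          (count≡0⇒absent c (c v) xs none , inS′)
      as-bound : length as < 2 ^ t
      as-bound = palette-bound t S′ |S′|≤ as (AllPairs-++⁻ˡ as u) (Linked-++⁻ˡ as l)
        (restrict as (ℕ.m+n≡0⇒m≡0 _ others-absent) (All.++⁻ˡ as inS))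
      cs-bound : length cs < 2 ^ t
      cs-bound = palette-bound t S′ |S′|≤ cs (AllPairs-++⁻ʳ (v ∷ []) (AllPairs-++⁻ʳ as u))
        (Linked-++⁻ʳ (v ∷ []) (Linked-++⁻ʳ as l))
        (restrict cs (ℕ.m+n≡0⇒n≡0 (count c (c v) as) others-absent) (All.tail (All.++⁻ʳ as inS)))

  path-length : ∀ {p} → IsPath D p → length p < 2 ^ k
  path-length {p} (_ , u , l) = palette-bound k (allFin k) (ℕ.≤-reflexive (length-tabulate id))
    p u l (All.tabulate (λ {x} _ → ∈-allFin (c x)))

-- Deleting a vertex

_─_ : (G : Graph) → Fin (n G) → Graph
record { n = suc m ; adj = a ; sym = a-sym ; irref = a-irref } ─ v = record
  { n = m ; adj = λ x y → a (Fin.punchIn v x) (Fin.punchIn v y) ; sym = λ x y → a-sym _ _ ; irref = λ x → a-irref _ }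

─-embed : ∀ G v → Fin (n (G ─ v)) → Fin (n G)
─-embed record { n = suc _ } v = Fin.punchIn v

─-embed-≢ : ∀ G v x → v ≢ ─-embed G v x
─-embed-≢ record { n = suc _ } v x = Fin.punchInᵢ≢i v x ∘ sym

─-embed-injective : ∀ G v → Injective _≡_ _≡_ (─-embed G v)
─-embed-injective record { n = suc _ } v = Fin.punchIn-injective v _ _

─-adj : ∀ G v x y → adj (G ─ v) x y ≡ adj G (─-embed G v x) (─-embed G v y)
─-adj record { n = suc _ } v x y = refl

─-restrict : ∀ G v {x} → v ≢ x → Fin (n (G ─ v))
─-restrict record { n = suc _ } v v≢x = Fin.punchOut v≢x

─-restrict-irrelevant : ∀ G v {x} (p q : v ≢ x) → ─-restrict G v p ≡ ─-restrict G v q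
─-restrict-irrelevant record { n = suc _ } v p q = Fin.punchOut-cong v refl

─-restrict-embed : ∀ G v {y} (v≢y : v ≢ ─-embed G v y) → ─-restrict G v v≢y ≡ y
─-restrict-embed record { n = suc _ } v {y} v≢y = trans (Fin.punchOut-cong v refl) (Fin.punchOut-punchIn v)

─-embed-restrict : ∀ G v {x} (v≢x : v ≢ x) → ─-embed G v (─-restrict G v v≢x) ≡ x
─-embed-restrict record { n = suc _ } v v≢x = Fin.punchIn-punchOut v≢x

module _ (G : Graph) (v : Fin (n G)) where

  restrict-all : ∀ {p} → All (v ≢_) p → List (Fin (n (G ─ v)))
  restrict-all []          = []
  restrict-all (v≢x ∷ v≢p) = ─-restrict G v v≢x ∷ restrict-all v≢p

  embed-restrict-all : ∀ {p} (v≢p : All (v ≢_) p) → map (─-embed G v) (restrict-all v≢p) ≡ p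
  embed-restrict-all []          = refl
  embed-restrict-all (v≢x ∷ v≢p) = cong₂ _∷_ (─-embed-restrict G v v≢x) (embed-restrict-all v≢p)

  ─-path : ∀ {p} → IsPath G p → (v≢p : All (v ≢_) p) → IsPath (G ─ v) (restrict-all v≢p)
  ─-path {p} (p≢[] , u , l) v≢p =
      (λ q≡[] → p≢[] (trans (sym (embed-restrict-all v≢p)) (cong (map (─-embed G v)) q≡[])))
    , Unique.map⁻ (subst Unique (sym (embed-restrict-all v≢p)) u)
    , Linked.map (λ {x} {y} → subst (_≡ true) (sym (─-adj G v x y)))
        (Linked.map⁻ (subst (Linked (Edge G)) (sym (embed-restrict-all v≢p)) l))

  length-restrict-all : ∀ {p} (v≢p : All (v ≢_) p) → length (restrict-all v≢p) ≡ length p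
  length-restrict-all []          = refl
  length-restrict-all (_ ∷ v≢p) = cong suc (length-restrict-all v≢p)

─-size : ∀ G v → suc (n (G ─ v)) ≡ n G
─-size record { n = suc _ } v = refl

─-proper : ∀ G v → (G ─ v) ⊂ G
─-proper G v = record { emb = ─-embed G v ; inj = ─-embed-injective G v ; edge = edge } , not-iso
  where
    edge : ∀ x y → Edge (G ─ v) x y → Edge G (─-embed G v x) (─-embed G v y)
    edge x y = subst (_≡ true) (─-adj G v x y)
    not-iso : ¬ (G ─ v) ≅ G
    not-iso iso with Fin.pigeonhole (ℕ.≤-reflexive (─-size G v)) (_≅_.from iso)
    ... | i , j , i<j , same = Fin.<⇒≢ i<j (begin
      i                            ≡⟨ sym (_≅_.to∘from iso i) ⟩
      _≅_.to iso (_≅_.from iso i)  ≡⟨ cong (_≅_.to iso) same ⟩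
      _≅_.to iso (_≅_.from iso j)  ≡⟨ _≅_.to∘from iso j ⟩
      j                            ∎)
      where open ≡-Reasoning

path-length-bound : ∀ {G k} → (∀ v → χlin≤ (G ─ v) k) → ∀ {p} → IsPath G p → length p < suc (2 ^ k)
path-length-bound             _          {[]}         ([]≢[] , _)         = contradiction refl []≢[]
path-length-bound {k = k}     _          {v ∷ []}     _                   = s≤s (ℕ.m^n>0 2 k)
path-length-bound {G} {k} colourable {v ∷ p@(_ ∷ _)} (_ , v≢p ∷ u , l) = s≤s (begin-strict
  length p                                            ≡⟨ length-restrict-all G v v≢p ⟨
  length (restrict-all G v v≢p)                       <⟨ path-length (G ─ v) (proj₂ (colourable v)) (─-path G v p-path v≢p) ⟩
  2 ^ k                                               ∎)
  where
    open ℕ.≤-Reasoning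
    p-path : IsPath G p
    p-path = (λ ()) , u , Linked-++⁻ʳ (v ∷ []) l

-- Replicas

module _ (G : Graph) where

  record Replicas (s M : ℕ) : Set where
    field
      copy                : Fin (suc M) → Fin (suc s) → Fin (n G)
      attachments         : List (Fin (n G))
      copy-injective      : ∀ j → Injective _≡_ _≡_ (copy j)
      copies-disjoint     : ∀ {j j′ i i′} → copy j i ≡ copy j′ i′ → j ≡ j′
      copy-adj            : ∀ j i i′ → adj G (copy j i) (copy j i′) ≡ adj G (copy zero i) (copy zero i′)
      copy-adj-attachment : ∀ j i {a} → a ∈ attachments → adj G (copy j i) a ≡ adj G (copy zero i) a
      first-copy-closed   : ∀ i {y} → Edge G (copy zero i) y → (∃ λ i′ → copy zero i′ ≡ y) ⊎ y ∈ attachments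

  module Transfer {k L s M} (R : Replicas s M) (many : suc k ^ suc s * L < M)
                  (short : ∀ {p} → IsPath G p → length p < L)
                  (colourable : χlin≤ (G ─ Replicas.copy R zero zero) k) where
    open Replicas R

    x₀ : Fin (n G)
    x₀ = copy zero zero

    cD : Fin (n (G ─ x₀)) → Fin k
    cD = proj₁ colourable

    x₀≢copy : ∀ j i → x₀ ≢ copy (suc j) i
    x₀≢copy j i x₀≡ = Fin.0≢1+n (copies-disjoint x₀≡)

    scheme : Fin M → Fin (suc s) → Fin k
    scheme j i = cD (─-restrict G x₀ (x₀≢copy j i))

    alike : LargeSublist (Homogeneous (λ i j → toℕ (scheme j i)) (allFin (suc s))) L (allFin M)
    alike = multi-pigeonhole _ (suc k) (allFin (suc s)) (Unique.allFin⁺ M)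
      (λ {j} _ i → ℕ.<-trans (Fin.toℕ<n (scheme j i)) (ℕ.n<1+n k))
      (subst₂ (λ d m → suc k ^ d * L < m) (sym (length-tabulate {n = suc s} id)) (sym (length-tabulate {n = M} id)) many)

    group : List (Fin M)
    group = elems alike

    j₀ : Fin M
    j₀ = lookup group (Fin.fromℕ< (ℕ.≤-trans (s≤s z≤n) (large alike)))

    same-scheme : ∀ {j} → j ∈ group → ∀ i → scheme j i ≡ scheme j₀ i
    same-scheme j∈ i = Fin.toℕ-injective (property alike (∈-allFin i) j∈ (∈-lookup _))

    InFirstCopy : Fin (n G) → Set
    InFirstCopy x = ∃ λ i → copy zero i ≡ x

    inFirstCopy? : ∀ x → Dec (InFirstCopy x)
    inFirstCopy? x = Fin.any? (λ i → copy zero i Fin.≟ x)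

    outside⇒≢x₀ : ∀ {x} → ¬ InFirstCopy x → x₀ ≢ x
    outside⇒≢x₀ x∉ x₀≡x = x∉ (zero , x₀≡x)

    colour : ∀ x → Dec (InFirstCopy x) → Fin k
    colour x (yes (i , _)) = scheme j₀ i
    colour x (no x∉)       = cD (─-restrict G x₀ (outside⇒≢x₀ x∉))

    cG : Fin (n G) → Fin k
    cG x = colour x (inFirstCopy? x)

    cG-first-copy : ∀ i → cG (copy zero i) ≡ scheme j₀ i
    cG-first-copy i with inFirstCopy? (copy zero i)
    ... | yes (i′ , same) = cong (scheme j₀) (copy-injective zero same)
    ... | no  x∉          = contradiction (i , refl) x∉

    cG-outside : ∀ {x} → ¬ InFirstCopy x → (x₀≢x : x₀ ≢ x) → cG x ≡ cD (─-restrict G x₀ x₀≢x)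
    cG-outside {x} x∉ x₀≢x with inFirstCopy? x
    ... | yes x∈ = contradiction x∈ x∉
    ... | no  _  = cong cD (─-restrict-irrelevant G x₀ _ _)

    copy-suc-outside : ∀ j i → ¬ InFirstCopy (copy (suc j) i)
    copy-suc-outside j i (_ , same) = Fin.0≢1+n (copies-disjoint same)

    missed-copy : ∀ {P} → IsPath G P → ∃ λ j → j ∈ group × (∀ i → copy (suc j) i ∉ P)
    missed-copy {P} P-path = decide (All.all? hit? group)
      where
        Hit : Fin M → Set
        Hit j = ∃ λ i → copy (suc j) i ∈ P
        hit? : ∀ j → Dec (Hit j)
        hit? j = Fin.any? (λ i → copy (suc j) i ∈? P)
          where open DecMembership (Fin._≟_ {n G}) using (_∈?_)
        same-copy : ∀ {j j′ y} → (∃ λ i → copy (suc j) i ≡ y) → (∃ λ i′ → copy (suc j′) i′ ≡ y) → j ≡ j′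
        same-copy (_ , refl) (_ , same) = Fin.suc-injective (copies-disjoint (sym same))
        decide : Dec (All Hit group) → ∃ λ j → j ∈ group × (∀ i → copy (suc j) i ∉ P)
        decide (yes all-hit) = contradiction
          (ℕ.<-≤-trans (large alike) (length-≤-by-injection Fin._≟_ same-copy (unique alike)
                                        (All.map (λ (i , i∈P) → Any.map (i ,_) i∈P) all-hit)))
          (ℕ.<-asym (short P-path))
        decide (no some-missed) with find (All.¬All⇒Any¬ hit? group some-missed)
        ... | j , j∈ , missed = j , j∈ , λ i i∈P → missed (i , i∈P)

    module Swap (j : Fin M) where

      swapped : ∀ x → Dec (InFirstCopy x) → Fin (n G)
      swapped x (yes (i , _)) = copy (suc j) i
      swapped x (no _)        = x

      swap : Fin (n G) → Fin (n G)
      swap x = swapped x (inFirstCopy? x)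

      swap-first-copy : ∀ i → swap (copy zero i) ≡ copy (suc j) i
      swap-first-copy i with inFirstCopy? (copy zero i)
      ... | yes (i′ , same) = cong (copy (suc j)) (copy-injective zero same)
      ... | no  x∉          = contradiction (i , refl) x∉

      swap-other : ∀ {x} → ¬ InFirstCopy x → swap x ≡ x
      swap-other {x} x∉ with inFirstCopy? x
      ... | yes x∈ = contradiction x∈ x∉
      ... | no  _  = refl

      swap-outside : ∀ x → ¬ InFirstCopy (swap x)
      swap-outside x with inFirstCopy? x
      ... | yes (i , _) = copy-suc-outside j i
      ... | no  x∉      = x∉

      swap-edge : ∀ {x y} → Edge G x y → Edge G (swap x) (swap y)
      swap-edge {x} {y} e with inFirstCopy? x | inFirstCopy? y
      ... | yes (i , refl) | yes (i′ , refl) = trans (copy-adj (suc j) i i′) e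
      ... | yes (i , refl) | no  y∉ with first-copy-closed i e
      ...   | inj₁ y∈  = contradiction y∈ y∉
      ...   | inj₂ y∈A = trans (copy-adj-attachment (suc j) i y∈A) e
      swap-edge {x} {y} e | no x∉ | yes (i′ , refl) with first-copy-closed i′ (Edge-sym G e)
      ...   | inj₁ x∈  = contradiction x∈ x∉
      ...   | inj₂ x∈A = Edge-sym G (trans (copy-adj-attachment (suc j) i′ x∈A) (Edge-sym G e))
      swap-edge e | no _ | no _ = e

      swap-injective : ∀ {P} → (∀ i → copy (suc j) i ∉ P) →
                       ∀ {x y} → x ∈ P → y ∈ P → swap x ≡ swap y → x ≡ y
      swap-injective {P} missed {x} {y} x∈P y∈P same with inFirstCopy? x | inFirstCopy? y
      ... | yes (i , refl) | yes (i′ , refl) = cong (copy zero) (copy-injective (suc j) same)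
      ... | yes (i , refl) | no  _           = contradiction (subst (_∈ P) (sym same) y∈P) (missed i)
      ... | no  _          | yes (i′ , refl) = contradiction (subst (_∈ P) same x∈P) (missed i′)
      ... | no  _          | no  _           = same

      swap-colour : j ∈ group → ∀ x → cG x ≡ cG (swap x)
      swap-colour j∈ x = by-cases (inFirstCopy? x)
        where
          by-cases : Dec (InFirstCopy x) → cG x ≡ cG (swap x)
          by-cases (yes (i , refl)) = begin
            cG (copy zero i)         ≡⟨ cG-first-copy i ⟩
            scheme j₀ i              ≡⟨ same-scheme j∈ i ⟨
            scheme j i               ≡⟨ cG-outside (copy-suc-outside j i) (x₀≢copy j i) ⟨
            cG (copy (suc j) i)      ≡⟨ cong cG (swap-first-copy i) ⟨
            cG (swap (copy zero i))  ∎
            where open ≡-Reasoning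
          by-cases (no x∉) = cong cG (sym (swap-other x∉))

    linear : LinearColoring G k cG
    linear P P-path with missed-copy P-path
    ... | j , j∈ , missed =
      UniquelyColoured-map⁻ swap (λ {x} _ → swap-colour j∈ x)
        (subst (UniquelyColoured cG) (embed-restrict-all G x₀ x₀∉Q)
          (UniquelyColoured-map⁺ (─-embed G x₀) q-colours (proj₂ colourable q q-path)))
      where
        open Swap j
        Q : List (Fin (n G))
        Q = map swap P
        Q-path : IsPath G Q
        Q-path = IsPath-map {G} {G} swap (swap-injective missed) swap-edge P-path
        x₀∉Q : All (x₀ ≢_) Q
        x₀∉Q = All.map⁺ (All.tabulate (λ {x} _ → outside⇒≢x₀ (swap-outside x)))
        q : List (Fin (n (G ─ x₀)))
        q = restrict-all G x₀ x₀∉Q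
        q-path : IsPath (G ─ x₀) q
        q-path = ─-path G x₀ Q-path x₀∉Q
        q-colours : ∀ {y} → y ∈ q → cD y ≡ cG (─-embed G x₀ y)
        q-colours {y} y∈q with ∈-map⁻ swap (subst (─-embed G x₀ y ∈_) (embed-restrict-all G x₀ x₀∉Q) (∈-map⁺ _ y∈q))
        ... | x , _ , y≡swap-x = sym (begin
          cG (─-embed G x₀ y)                            ≡⟨ cG-outside outside (─-embed-≢ G x₀ y) ⟩
          cD (─-restrict G x₀ (─-embed-≢ G x₀ y))        ≡⟨ cong cD (─-restrict-embed G x₀ _) ⟩
          cD y                                           ∎)
          where
            open ≡-Reasoning
            outside : ¬ InFirstCopy (─-embed G x₀ y)
            outside = subst (¬_ ∘ InFirstCopy) (sym y≡swap-x) (swap-outside x)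

  replicas⇒χlin≤ : ∀ {k L s M} (R : Replicas s M) → suc k ^ suc s * L < M →
                   (∀ {p} → IsPath G p → length p < L) →
                   χlin≤ (G ─ Replicas.copy R zero zero) k → χlin≤ G k
  replicas⇒χlin≤ R many short colourable = cG , linear
    where open Transfer R many short colourable

module Walks (G : Graph) where

  infixr 5 _∷⟨_⟩_

  data Walk (P : Fin (n G) → Set) : Fin (n G) → Fin (n G) → Set where
    [_]    : ∀ {a} → P a → Walk P a a
    _∷⟨_⟩_ : ∀ {a b c} → P a → Edge G a b → Walk P b c → Walk P a c

  module _ {P : Fin (n G) → Set} where

    source∈ : ∀ {a b} → Walk P a b → P a
    source∈ [ pa ]        = pa
    source∈ (pa ∷⟨ _ ⟩ _) = pa

    target∈ : ∀ {a b} → Walk P a b → P b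
    target∈ [ pb ]       = pb
    target∈ (_ ∷⟨ _ ⟩ w) = target∈ w

    _∷ʳ⟨_⟩_ : ∀ {a b c} → Walk P a b → Edge G b c → P c → Walk P a c
    [ pa ]          ∷ʳ⟨ e ⟩ pc = pa ∷⟨ e ⟩ [ pc ]
    (pa ∷⟨ e′ ⟩ w) ∷ʳ⟨ e ⟩ pc = pa ∷⟨ e′ ⟩ (w ∷ʳ⟨ e ⟩ pc)

    _++ʷ_ : ∀ {a b c} → Walk P a b → Walk P b c → Walk P a c
    [ _ ]          ++ʷ w′ = w′
    (pa ∷⟨ e ⟩ w) ++ʷ w′ = pa ∷⟨ e ⟩ (w ++ʷ w′)

    reverseʷ : ∀ {a b} → Walk P a b → Walk P b a
    reverseʷ [ pa ]         = [ pa ]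
    reverseʷ (pa ∷⟨ e ⟩ w) = reverseʷ w ∷ʳ⟨ Edge-sym G e ⟩ pa

  mapʷ : ∀ {P Q : Fin (n G) → Set} {a b} → (∀ {x} → P x → Q x) → Walk P a b → Walk Q a b
  mapʷ f [ pa ]         = [ f pa ]
  mapʷ f (pa ∷⟨ e ⟩ w) = f pa ∷⟨ e ⟩ mapʷ f w

  prefixes : ∀ {P a b} → Walk P a b → Walk (Walk P a) a b
  prefixes [ pa ]         = [ [ pa ] ]
  prefixes (pa ∷⟨ e ⟩ w) = [ pa ] ∷⟨ e ⟩ mapʷ (pa ∷⟨ e ⟩_) (prefixes w)

-- Short paths and no replicas bound the size

bit : Bool → ℕ
bit false = 0
bit true  = 1

bit-injective : ∀ {a b} → bit a ≡ bit b → a ≡ b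
bit-injective {false} {false} _ = refl
bit-injective {true}  {true}  _ = refl

bit≤1 : ∀ a → bit a ≤ 1
bit≤1 false = z≤n
bit≤1 true  = ≤-refl

-- A component with at most B vertices has one of profileCount B |A| profiles (1 + B·B + B·|A|
-- numbers below B + 2), so more than componentBound M B |A| components contain M B + 1 replicas.
profileCount : ℕ → ℕ → ℕ
profileCount B a = suc (suc B) ^ suc (B * B + B * a)

componentBound : (ℕ → ℕ) → ℕ → ℕ → ℕ
componentBound M B a = profileCount B a * M B

rootedBound : (ℕ → ℕ) → ℕ → ℕ → ℕ
rootedBound M zero    a = 0
rootedBound M (suc d) a = suc (componentBound M B (suc a) * B)
  where B = rootedBound M d (suc a)

graphBound : (ℕ → ℕ) → ℕ → ℕ
graphBound M L = componentBound M B 0 * B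
  where B = rootedBound M L 0

module SizeBound (G : Graph) (M : ℕ → ℕ) (M-mono : ∀ {a b} → a ≤ b → M a ≤ M b)
                 (no-replicas : ∀ {s N} → Replicas G s N → M (suc s) ≤ N → ⊥) where
  open Walks G

  module Components (W : Fin (n G) → Set) (A : List (Fin (n G))) (Root : Fin (n G) → Set) (B : ℕ)
    (root⇒W  : ∀ {c} → Root c → W c)
    (closed  : ∀ {c x y} → Root c → Walk W c x → Edge G x y → Walk W c y ⊎ y ∈ A)
    (bounded : ∀ {c ys} → Root c → Unique ys → All (Walk W c) ys → DoubleNegation (length ys ≤ B))
    (covered : ∀ {x} → W x → ∃ λ c → Root c × Walk W c x) where

    Apart : Fin (n G) → Fin (n G) → Set
    Apart c c′ = ¬ Walk W c c′

    Apart-sym : ∀ {c c′} → Apart c c′ → Apart c′ c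
    Apart-sym apart = apart ∘ reverseʷ

    representatives-unique : ∀ {cs} → All Root cs → AllPairs Apart cs → Unique cs
    representatives-unique []             []             = []
    representatives-unique (root ∷ roots) (apart ∷ aparts) =
      All.map (λ { apart′ refl → apart′ [ root⇒W root ] }) apart ∷ representatives-unique roots aparts

    module Decided (comp? : ∀ c x → Dec (Walk W c x)) where

      Covers : List (Fin (n G)) → Fin (n G) → Set
      Covers cs x = Any (λ c → Walk W c x) cs

      representatives : ∀ {xs} → All W xs → ∃ λ cs → All Root cs × AllPairs Apart cs × All (Covers cs) xs
      representatives []          = [] , [] , [] , []
      representatives {x ∷ _} (Wx ∷ Wxs) with representatives Wxs
      ... | cs , roots , aparts , covers with Any.any? (λ c → comp? c x) cs
      ...   | yes x-covered = cs , roots , aparts , x-covered ∷ covers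
      ...   | no  x-new with covered Wx
      ...     | c , root , c→x =
        c ∷ cs , root ∷ roots , All.tabulate new-apart ∷ aparts , here c→x ∷ All.map there covers
        where
          new-apart : ∀ {c′} → c′ ∈ cs → Apart c c′
          new-apart c′∈ c→c′ = x-new (Any.map (λ { refl → reverseʷ c→c′ ++ʷ c→x }) c′∈)

      members : Fin (n G) → List (Fin (n G))
      members c = filter (comp? c) (allFin (n G))

      members-unique : ∀ {c} → Unique (members c)
      members-unique {c} = Unique.filter⁺ (comp? c) (Unique.allFin⁺ (n G))

      ∈-members⁺ : ∀ {c x} → Walk W c x → x ∈ members c
      ∈-members⁺ {c} {x} = ∈-filter⁺ (comp? c) (∈-allFin x)

      ∈-members⁻ : ∀ {c x} → x ∈ members c → Walk W c x
      ∈-members⁻ {c} = proj₂ ∘ ∈-filter⁻ (comp? c) {xs = allFin (n G)}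

      covered-length : ∀ cs {xs} → Unique xs → All (Covers cs) xs → All (λ c → length (members c) ≤ B) cs →
                       length xs ≤ length cs * B
      covered-length []       {[]}    _ _          _ = z≤n
      covered-length []       {_ ∷ _} _ (() ∷ _)   _
      covered-length (c ∷ cs) {xs}    u covers (|c|≤B ∷ sizes) = begin
        length xs                                                        ≡⟨ length-filter-∁ (comp? c) xs ⟨
        length (filter (comp? c) xs) + length (filter (∁? (comp? c)) xs) ≤⟨ ℕ.+-mono-≤ in-c in-cs ⟩
        B + length cs * B                                                ∎
        where
          open ℕ.≤-Reasoning
          in-c : length (filter (comp? c) xs) ≤ B
          in-c = ≤-trans (length-≤-⊆ Fin._≟_ (Unique.filter⁺ (comp? c) u)
                                     (∈-members⁺ ∘ proj₂ ∘ ∈-filter⁻ (comp? c) {xs = xs})) |c|≤B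
          elsewhere : ∀ {x} → ¬ Walk W c x → Covers (c ∷ cs) x → Covers cs x
          elsewhere c↛x (here c→x) = contradiction c→x c↛x
          elsewhere _   (there x∈) = x∈
          in-cs : length (filter (∁? (comp? c)) xs) ≤ length cs * B
          in-cs = covered-length cs (Unique.filter⁺ (∁? (comp? c)) u)
            (All.tabulate (λ x∈ → let x∈xs , c↛x = ∈-filter⁻ (∁? (comp? c)) {xs = xs} x∈ in
                                  elsewhere c↛x (All.lookup covers x∈xs)))
            sizes

      data Feature : Set where
        size  : Feature
        inner : ℕ → ℕ → Feature
        outer : ℕ → Fin (n G) → Feature

      features : List Feature
      features = size ∷ cartesianProductWith inner (upTo B) (upTo B) ++ cartesianProductWith outer (upTo B) A

      length-features : length features ≡ suc (B * B + B * length A)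
      length-features = cong suc (begin
        length (cartesianProductWith inner (upTo B) (upTo B) ++ cartesianProductWith outer (upTo B) A)
          ≡⟨ length-++ (cartesianProductWith inner (upTo B) (upTo B)) ⟩
        length (cartesianProductWith inner (upTo B) (upTo B)) + length (cartesianProductWith outer (upTo B) A)
          ≡⟨ cong₂ _+_ (length-cartesianProductWith inner (upTo B) (upTo B))
                       (length-cartesianProductWith outer (upTo B) A) ⟩
        length (upTo B) * length (upTo B) + length (upTo B) * length A
          ≡⟨ cong (λ b → b * b + b * length A) (length-upTo B) ⟩
        B * B + B * length A ∎)
        where open ≡-Reasoning

      inner∈features : ∀ {i i′} → i < B → i′ < B → inner i i′ ∈ features
      inner∈features i<B i′<B = there (∈-++⁺ˡ (∈-cartesianProductWith⁺ inner (∈-upTo⁺ i<B) (∈-upTo⁺ i′<B)))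

      outer∈features : ∀ {i a} → i < B → a ∈ A → outer i a ∈ features
      outer∈features i<B a∈A = there (∈-++⁺ʳ _ (∈-cartesianProductWith⁺ outer (∈-upTo⁺ i<B) a∈A))

      edgeBit : Maybe (Fin (n G)) → Maybe (Fin (n G)) → ℕ
      edgeBit (just x) (just y) = bit (adj G x y)
      edgeBit _        _        = 0

      edgeBit≤1 : ∀ x y → edgeBit x y ≤ 1
      edgeBit≤1 (just x) (just y) = bit≤1 (adj G x y)
      edgeBit≤1 (just _) nothing  = z≤n
      edgeBit≤1 nothing  _        = z≤n

      vertexAt : Fin (n G) → ℕ → Maybe (Fin (n G))
      vertexAt c i = head (drop i (members c))

      -- Positions index the sorted member list of a component; a position past its end
      -- reads as the junk bit 0, harmless since equal profiles have equal sizes.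
      profile : Feature → Fin (n G) → ℕ
      profile size         c = length (members c)
      profile (inner i i′) c = edgeBit (vertexAt c i) (vertexAt c i′)
      profile (outer i a)  c = edgeBit (vertexAt c i) (just a)

      profile< : ∀ {c} → length (members c) ≤ B → ∀ φ → profile φ c < suc (suc B)
      profile< |c|≤B size         = s≤s (ℕ.m≤n⇒m≤1+n |c|≤B)
      profile< {c} _ (inner i i′) = s≤s (≤-trans (edgeBit≤1 (vertexAt c i) (vertexAt c i′)) (s≤s z≤n))
      profile< {c} _ (outer i a)  = s≤s (≤-trans (edgeBit≤1 (vertexAt c i) (just a)) (s≤s z≤n))

      module FromGroup {cs} (roots : All Root cs) (aparts : AllPairs Apart cs)
                       (sizes : All (λ c → length (members c) ≤ B) cs)
                       (S : LargeSublist (Homogeneous profile features) (M B) cs) where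

        root : Fin (suc (M B)) → Fin (n G)
        root j = lookup (elems S) (Fin.inject≤ j (large S))

        root∈cs : ∀ j → root j ∈ cs
        root∈cs j = ⊆xs S (∈-lookup _)

        root-injective : ∀ {j j′} → root j ≡ root j′ → j ≡ j′
        root-injective {j} {j′} same = Fin.toℕ-injective (begin
          toℕ j                             ≡⟨ Fin.toℕ-inject≤ j (large S) ⟨
          toℕ (Fin.inject≤ j (large S))     ≡⟨ cong toℕ (lookup-injective (unique S) same) ⟩
          toℕ (Fin.inject≤ j′ (large S))    ≡⟨ Fin.toℕ-inject≤ j′ (large S) ⟩
          toℕ j′                            ∎)
          where open ≡-Reasoning

        same-profile : ∀ {φ} → φ ∈ features → ∀ j → profile φ (root j) ≡ profile φ (root zero)
        same-profile φ∈ j = property S φ∈ (∈-lookup _) (∈-lookup _)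

        s : ℕ
        s = ℕ.pred (length (members (root zero)))

        |members₀| : length (members (root zero)) ≡ suc s
        |members₀| = length-nonempty (∈-members⁺ [ root⇒W (All.lookup roots (root∈cs zero)) ])

        |members| : ∀ j → length (members (root j)) ≡ suc s
        |members| j = trans (same-profile (here refl) j) |members₀|

        s<B : suc s ≤ B
        s<B = subst (_≤ B) |members₀| (All.lookup sizes (root∈cs zero))

        copy : Fin (suc (M B)) → Fin (suc s) → Fin (n G)
        copy j = at (members (root j)) (|members| j)

        vertexAt-copy : ∀ j i → vertexAt (root j) (toℕ i) ≡ just (copy j i)
        vertexAt-copy j = head-drop-at (|members| j)

        toℕ<B : ∀ (i : Fin (suc s)) → toℕ i < B
        toℕ<B i = <-≤-trans (Fin.toℕ<n i) s<B

        copy-walk : ∀ j i → Walk W (root j) (copy j i)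
        copy-walk j i = ∈-members⁻ (at-∈ (|members| j) i)

        copies-disjoint : ∀ {j j′ i i′} → copy j i ≡ copy j′ i′ → j ≡ j′
        copies-disjoint {j} {j′} {i} {i′} same with root j Fin.≟ root j′
        ... | yes root≡ = root-injective root≡
        ... | no  root≢ = contradiction
          (copy-walk j i ++ʷ reverseʷ (subst (Walk W (root j′)) (sym same) (copy-walk j′ i′)))
          (AllPairs-lookup Apart-sym aparts (root∈cs j) (root∈cs j′) root≢)

        copy-adj : ∀ j i i′ → adj G (copy j i) (copy j i′) ≡ adj G (copy zero i) (copy zero i′)
        copy-adj j i i′ = bit-injective (begin
          edgeBit (just (copy j i)) (just (copy j i′))
            ≡⟨ cong₂ edgeBit (vertexAt-copy j i) (vertexAt-copy j i′) ⟨
          profile (inner (toℕ i) (toℕ i′)) (root j)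
            ≡⟨ same-profile (inner∈features (toℕ<B i) (toℕ<B i′)) j ⟩
          profile (inner (toℕ i) (toℕ i′)) (root zero)
            ≡⟨ cong₂ edgeBit (vertexAt-copy zero i) (vertexAt-copy zero i′) ⟩
          edgeBit (just (copy zero i)) (just (copy zero i′)) ∎)
          where open ≡-Reasoning

        copy-adj-attachment : ∀ j i {a} → a ∈ A → adj G (copy j i) a ≡ adj G (copy zero i) a
        copy-adj-attachment j i {a} a∈A = bit-injective (begin
          edgeBit (just (copy j i)) (just a)     ≡⟨ cong (λ x → edgeBit x (just a)) (vertexAt-copy j i) ⟨
          profile (outer (toℕ i) a) (root j)     ≡⟨ same-profile (outer∈features (toℕ<B i) a∈A) j ⟩
          profile (outer (toℕ i) a) (root zero)  ≡⟨ cong (λ x → edgeBit x (just a)) (vertexAt-copy zero i) ⟩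
          edgeBit (just (copy zero i)) (just a)  ∎)
          where open ≡-Reasoning

        first-copy-closed : ∀ i {y} → Edge G (copy zero i) y → (∃ λ i′ → copy zero i′ ≡ y) ⊎ y ∈ A
        first-copy-closed i e with closed (All.lookup roots (root∈cs zero)) (copy-walk zero i) e
        ... | inj₁ root→y = inj₁ (at-surjective (|members| zero) (∈-members⁺ root→y))
        ... | inj₂ y∈A    = inj₂ y∈A

        replicas : Replicas G s (M B)
        replicas = record
          { copy                = copy
          ; attachments         = A
          ; copy-injective      = λ j → at-injective (|members| j) members-unique
          ; copies-disjoint     = copies-disjoint
          ; copy-adj            = copy-adj
          ; copy-adj-attachment = copy-adj-attachment
          ; first-copy-closed   = first-copy-closed
          }

        impossible : ⊥
        impossible = no-replicas replicas (M-mono s<B)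

      few-components : ∀ {cs} → All Root cs → AllPairs Apart cs → All (λ c → length (members c) ≤ B) cs →
                       length cs ≤ componentBound M B (length A)
      few-components {cs} roots aparts sizes = ℕ.≮⇒≥ λ many → FromGroup.impossible roots aparts sizes
        (multi-pigeonhole profile (suc (suc B)) features (representatives-unique roots aparts)
          (λ c∈ → profile< (All.lookup sizes c∈))
          (subst (λ d → suc (suc B) ^ d * M B < length cs) (sym length-features) many))

      decided-size-bound : ∀ {xs} → Unique xs → All W xs →
                           DoubleNegation (length xs ≤ componentBound M B (length A) * B)
      decided-size-bound u Wxs with representatives Wxs
      ... | cs , roots , aparts , covers = do
        sizes ← ¬¬-All cs (λ c∈ → bounded (All.lookup roots c∈) members-unique (All.tabulate ∈-members⁻))
        pure (≤-trans (covered-length cs u covers sizes) (ℕ.*-monoˡ-≤ B (few-components roots aparts sizes)))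

    -- Walk W c x is not decidable for an arbitrary W, but deciders exist under ¬¬.
    size-bound : ∀ {xs} → Unique xs → All W xs → DoubleNegation (length xs ≤ componentBound M B (length A) * B)
    size-bound u Wxs = do
      comp? ← ¬¬-∀Fin (λ c → ¬¬-∀Fin (λ x → ¬¬-excluded-middle))
      Decided.decided-size-bound comp? u Wxs

  record Rooted (U : Fin (n G) → Set) (r : Fin (n G)) (A : List (Fin (n G))) (depth : ℕ) : Set where
    field
      root∈     : U r
      reachable : ∀ {x} → U x → Walk U r x
      closed    : ∀ {x y} → U x → Edge G x y → U y ⊎ y ∈ A
      shallow   : ∀ {ps} → Unique (r ∷ ps) → Linked (Edge G) (r ∷ ps) → All U ps → length ps < depth

  component-rooted : ∀ {W c A depth} → W c →
                     (∀ {x y} → Walk W c x → Edge G x y → Walk W c y ⊎ y ∈ A) →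
                     (∀ {ps} → Unique (c ∷ ps) → Linked (Edge G) (c ∷ ps) → All (Walk W c) ps → length ps < depth) →
                     Rooted (Walk W c) c A depth
  component-rooted Wc closed shallow = record
    { root∈ = [ Wc ] ; reachable = prefixes ; closed = closed ; shallow = shallow }

  last-exit : ∀ {U : Fin (n G) → Set} {r a x} → Walk U a x → x ≢ r →
              Walk (λ y → U y × y ≢ r) a x ⊎ ∃ λ c → Edge G r c × Walk (λ y → U y × y ≢ r) c x
  last-exit [ Ux ] x≢r = inj₁ [ Ux , x≢r ]
  last-exit {r = r} (_∷⟨_⟩_ {a} Ua e w) x≢r with last-exit w x≢r
  ... | inj₂ exit = inj₂ exit
  ... | inj₁ w′ with a Fin.≟ r
  ...   | yes refl = inj₂ (_ , e , w′)
  ...   | no  a≢r  = inj₁ ((Ua , a≢r) ∷⟨ e ⟩ w′)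

  module Children {U r A depth} (R : Rooted U r A (suc depth)) where
    open Rooted R

    W : Fin (n G) → Set
    W y = U y × y ≢ r

    Child : Fin (n G) → Set
    Child c = Edge G r c × W c

    child-closed : ∀ {c x y} → Walk W c x → Edge G x y → Walk W c y ⊎ y ∈ r ∷ A
    child-closed {y = y} w e with closed (proj₁ (target∈ w)) e
    ... | inj₂ y∈A = inj₂ (there y∈A)
    ... | inj₁ Uy with y Fin.≟ r
    ...   | yes refl = inj₂ (here refl)
    ...   | no  y≢r  = inj₁ (w ∷ʳ⟨ e ⟩ (Uy , y≢r))

    child-rooted : ∀ {c} → Child c → Rooted (Walk W c) c (r ∷ A) depth
    child-rooted {c} (r~c , Wc) = component-rooted Wc child-closed λ {ps} u l c→ps →
      let r∉ : All (r ≢_) (c ∷ ps)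
          r∉ = (proj₂ Wc ∘ sym) ∷ All.map (λ c→p → proj₂ (target∈ c→p) ∘ sym) c→ps
      in ℕ.≤-pred (shallow (r∉ ∷ u) (r~c ∷ l) (proj₁ Wc ∷ All.map (proj₁ ∘ target∈) c→ps))

    child-cover : ∀ {x} → W x → ∃ λ c → Child c × Walk W c x
    child-cover (Ux , x≢r) with last-exit (reachable Ux) x≢r
    ... | inj₁ r→x           = contradiction refl (proj₂ (source∈ r→x))
    ... | inj₂ (c , r~c , w) = c , (r~c , source∈ w) , w

  rooted-size : ∀ depth {U r A} → Rooted U r A depth → ∀ {xs} → Unique xs → All U xs →
                DoubleNegation (length xs ≤ rootedBound M depth (length A))
  rooted-size zero        R _ _ = contradiction (Rooted.shallow R {[]} ([] ∷ []) [-] []) n≮0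
  rooted-size (suc depth) {U} {r} {A} R {xs} u Uxs = do
      bound ← C.size-bound (Unique.filter⁺ ≢r? u) (All.tabulate W-others)
      pure (≤-trans (length-filter-≢ Fin._≟_ r u) (s≤s bound))
    where
      open Children R
      module C = Components W (r ∷ A) Child (rootedBound M depth (suc (length A))) proj₂
                   (λ _ → child-closed) (λ child → rooted-size depth (child-rooted child)) child-cover

      ≢r? : Decidable (λ y → y ≢ r)
      ≢r? y = ¬? (y Fin.≟ r)

      W-others : ∀ {x} → x ∈ filter ≢r? xs → W x
      W-others x∈ with ∈-filter⁻ ≢r? {xs = xs} x∈
      ... | x∈xs , x≢r = All.lookup Uxs x∈xs , x≢r

  graph-size : ∀ {L} → (∀ {p} → IsPath G p → length p < L) → DoubleNegation (n G ≤ graphBound M L)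
  graph-size {L} short = do
      bound ← C.size-bound (Unique.allFin⁺ (n G)) (All.tabulate (λ _ → tt))
      pure (subst (_≤ graphBound M L) (length-tabulate id) bound)
    where
      Everything : Fin (n G) → Set
      Everything _ = ⊤

      closed : ∀ {c x y} → Walk Everything c x → Edge G x y → Walk Everything c y ⊎ y ∈ []
      closed w e = inj₁ (w ∷ʳ⟨ e ⟩ tt)

      component : ∀ c → Rooted (Walk Everything c) c [] L
      component c = component-rooted tt closed λ u l _ → ℕ.<-trans (ℕ.n<1+n _) (short ((λ ()) , u , l))

      module C = Components Everything [] Everything (rootedBound M L 0) id (λ _ → closed)
                   (λ {c} _ → rooted-size L (component c)) (λ {x} _ → x , tt , [ tt ])

-- Graphs of bounded size

vectors : ∀ {A : Set} → List A → (m : ℕ) → List (Vec A m)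
vectors xs zero    = [] ∷ []
vectors xs (suc m) = cartesianProductWith _∷_ xs (vectors xs m)

vectors-complete : ∀ {A : Set} {xs : List A} → (∀ a → a ∈ xs) → ∀ {m} (v : Vec A m) → v ∈ vectors xs m
vectors-complete every []      = here refl
vectors-complete every (a ∷ v) = ∈-cartesianProductWith⁺ _∷_ (every a) (vectors-complete every v)

booleans : List Bool
booleans = true ∷ false ∷ []

booleans-complete : ∀ b → b ∈ booleans
booleans-complete true  = here refl
booleans-complete false = there (here refl)

Table : ℕ → Set
Table m = Vec (Vec Bool m) m

tableAdj : ∀ {m} → Table m → Fin m → Fin m → Bool
tableAdj t u v = if does (u Fin.≟ v) then false else (Vec.lookup (Vec.lookup t u) v ∧ Vec.lookup (Vec.lookup t v) u)

tableAdj-sym : ∀ {m} (t : Table m) u v → tableAdj t u v ≡ tableAdj t v u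
tableAdj-sym t u v with u Fin.≟ v | v Fin.≟ u
... | yes _   | yes _   = refl
... | no  _   | no  _   = ∧-comm (Vec.lookup (Vec.lookup t u) v) _
... | yes u≡v | no  v≢u = contradiction (sym u≡v) v≢u
... | no  u≢v | yes v≡u = contradiction (sym v≡u) u≢v

tableAdj-irrefl : ∀ {m} (t : Table m) v → tableAdj t v v ≡ false
tableAdj-irrefl t v with v Fin.≟ v
... | yes _   = refl
... | no  v≢v = contradiction refl v≢v

tableGraph : ∀ m → Table m → Graph
tableGraph m t = record { n = m ; adj = tableAdj t ; sym = tableAdj-sym t ; irref = tableAdj-irrefl t }

table : (H : Graph) → Table (n H)
table H = Vec.tabulate (λ u → Vec.tabulate (adj H u))

table-≅ : ∀ H → H ≅ tableGraph (n H) (table H)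
table-≅ H = record { to = id ; from = id ; to∘from = λ _ → refl ; from∘to = λ _ → refl ; adj-pres = adj-pres }
  where
    adj-pres : ∀ u v → tableAdj (table H) u v ≡ adj H u v
    adj-pres u v with u Fin.≟ v
    ... | yes refl = sym (irref H u)
    ... | no  _    = begin
      Vec.lookup (Vec.lookup (table H) u) v ∧ Vec.lookup (Vec.lookup (table H) v) u
        ≡⟨ cong₂ _∧_ (lookup-table u v) (lookup-table v u) ⟩
      adj H u v ∧ adj H v u   ≡⟨ cong (adj H u v ∧_) (Graph.sym H v u) ⟩
      adj H u v ∧ adj H u v   ≡⟨ ∧-idem (adj H u v) ⟩
      adj H u v               ∎
      where
        open ≡-Reasoning
        lookup-table : ∀ u v → Vec.lookup (Vec.lookup (table H) u) v ≡ adj H u v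
        lookup-table u v = trans (cong (λ row → Vec.lookup row v) (Vec.lookup∘tabulate _ u)) (Vec.lookup∘tabulate _ v)

graphsOfSize : ℕ → List Graph
graphsOfSize m = map (tableGraph m) (vectors (vectors booleans m) m)

graphsUpTo : ℕ → List Graph
graphsUpTo N = concatMap graphsOfSize (upTo (suc N))

graphsUpTo-complete : ∀ {N} H → n H ≤ N → Any (H ≅_) (graphsUpTo N)
graphsUpTo-complete H |H|≤N = Any.concatMap⁺ graphsOfSize (Any.map (λ { refl → listed }) (∈-upTo⁺ (s≤s |H|≤N)))
  where
    listed : Any (H ≅_) (graphsOfSize (n H))
    listed = Any.map⁺ (Any.map (λ { refl → table-≅ H })
                               (vectors-complete (vectors-complete booleans-complete) (table H)))

pathBound : ℕ → ℕ
pathBound k = suc (2 ^ k)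

-- Among more than (k+1)^s (2^k+1) copies of an s-vertex piece, more than 2^k+1 are coloured alike.
copiesNeeded : ℕ → ℕ → ℕ
copiesNeeded k s = suc (suc k ^ s * pathBound k)

copiesNeeded-mono : ∀ k {a b} → a ≤ b → copiesNeeded k a ≤ copiesNeeded k b
copiesNeeded-mono k a≤b = s≤s (ℕ.*-monoˡ-≤ (pathBound k) (ℕ.^-monoʳ-≤ (suc k) a≤b))

obstructionBound : ℕ → ℕ
obstructionBound k = graphBound (copiesNeeded k) (pathBound k)

obstruction-size : ∀ k H → Obstruction k H → n H ≤ obstructionBound k
obstruction-size k H (not-colourable , minimal) =
  decidable-stable (n H ℕ.≤? obstructionBound k) (SizeBound.graph-size H (copiesNeeded k) (copiesNeeded-mono k) no-replicas short)
  where
    deletions-colourable : ∀ v → χlin≤ (H ─ v) k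
    deletions-colourable v = minimal (H ─ v) (─-proper H v)
    short : ∀ {p} → IsPath H p → length p < pathBound k
    short = path-length-bound deletions-colourable
    no-replicas : ∀ {s N} → Replicas H s N → copiesNeeded k (suc s) ≤ N → ⊥
    no-replicas R enough = not-colourable (replicas⇒χlin≤ H R enough short (deletions-colourable _))

corollary5p4 : ∀ (k : ℕ) → ∃ λ (L : List Graph) →
                 ∀ (H : Graph) → Obstruction k H → Any (λ H₀ → H ≅ H₀) L
corollary5p4 k = graphsUpTo (obstructionBound k) , λ H obstruction →
  graphsUpTo-complete H (obstruction-size k H obstruction)
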